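{- Let $n,t,r$ be positive integers with $n\geq 5$ and $t\in\{2,3\}$. Let $R_{(n,t)}$ be a regular graph of order $n$ in which every vertex has degree $n-t$, and suppose $r=rvcl(R_{(n,t)})\geq 3$. Consider a locating rainbow $r$-coloring of $R_{(n,t)}$ with color classes $R_1,\dots,R_r$. Then: (1) each rainbow code contains at most $t-1$ entries equal to $2$; (2) every color is used on at most $1+\sum_{k=1}^{t-1}\binom{r-1}{t-k}$ vertices; (3) for every color $w$, the number of vertices $v$ with $d(v,R_w)=2$ is at most $t-1$.
   Context: All graphs are finite, simple, undirected and connected; $d(u,v)$ denotes the distance in the graph, and for $S\subseteq V(G)$, $d(v,S)=\min\{d(v,y): y\in S\}$. A path between $x$ and $y$ is a rainbow vertex path (with respect to a vertex coloring) if its internal vertices all receive distinct colors. A rainbow vertex $k$-coloring of $G$ is a map $c:V(G)\to\{1,\dots,k\}$ such that every two distinct vertices $x,y$ are joined by a rainbow vertex $x$–$y$ path. For $i\in\{1,\dots,k\}$ let $R_i$ be the set of vertices of color $i$; the rainbow code of $v$ is $rc_\Pi(v)=(d(v,R_1),\dots,d(v,R_k))$, whose components are called its entries. A rainbow vertex $k$-coloring is a locating rainbow $k$-coloring if all vertices have pairwise distinct rainbow codes. The locating rainbow connection number $rvcl(G)$ is the smallest $k$ for which $G$ has a locating rainbow $k$-coloring. -}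

module Defs where

open import Data.Nat using (ℕ; zero; suc; _+_; _∸_; _≤_; _<_; _≥_)
open import Data.Nat.Combinatorics using (_C_)
open import Data.Fin using (Fin)
open import Data.Fin.Properties using (_≟_)
open import Data.Bool using (Bool; T)
open import Data.List using (List; []; _∷_; length; map; applyUpTo; filterᵇ; allFin)
open import Data.Nat.ListAction using (sum)
open import Data.List.Relation.Unary.All using (All)
open import Data.List.Relation.Unary.Unique.Propositional using (Unique)
open import Data.Product using (Σ; ∃; _×_; _,_)
open import Relation.Binary.PropositionalEquality using (_≡_; _≢_)
open import Relation.Nullary using (¬_)
open import Relation.Nullary.Decidable using (⌊_⌋)

record Graph (n : ℕ) : Set where
  field
    adj   : Fin n → Fin n → Bool
    sym   : ∀ u v → adj u v ≡ adj v u
    irrefl : ∀ v → adj v v ≡ Data.Bool.false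

open Graph public

Adj : ∀ {n} → Graph n → Fin n → Fin n → Set
Adj G u v = T (adj G u v)

data Walk {n} (G : Graph n) : Fin n → Fin n → ℕ → Set where
  []  : ∀ {u} → Walk G u u 0
  _∷_ : ∀ {u w v k} → Adj G u w → Walk G w v k → Walk G u v (suc k)

verts : ∀ {n} {G : Graph n} {u v k} → Walk G u v k → List (Fin n)
verts {u = u} []      = u ∷ []
verts {u = u} (e ∷ p) = u ∷ verts p

interior : ∀ {n} {G : Graph n} {u v k} → Walk G u v k → List (Fin n)
interior []                        = []
interior (e ∷ [])                  = []
interior (_∷_ {w = w} e (e' ∷ p))  = w ∷ interior (e' ∷ p)

Connected : ∀ {n} → Graph n → Set
Connected G = ∀ u v → ∃ λ k → Walk G u v k

degree : ∀ {n} → Graph n → Fin n → ℕ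
degree {n} G v = length (filterᵇ (adj G v) (allFin n))

Regular : ∀ {n} → Graph n → ℕ → Set
Regular G d = ∀ v → degree G v ≡ d

DistToSet : ∀ {n} → Graph n → Fin n → (Fin n → Set) → ℕ → Set
DistToSet {n} G v S m =
  (Σ (Fin n) λ y → S y × Walk G v y m) ×
  (∀ y → S y → ∀ j → j < m → ¬ Walk G v y j)

Class : ∀ {n k} → (Fin n → Fin k) → Fin k → Fin n → Set
Class c i v = c v ≡ i

RainbowPath : ∀ {n k} (G : Graph n) (c : Fin n → Fin k) {x y m} → Walk G x y m → Set
RainbowPath G c p = Unique (verts p) × Unique (map c (interior p))

RainbowVertexColoring : ∀ {n k} → Graph n → (Fin n → Fin k) → Set
RainbowVertexColoring {n} G c =
  ∀ (x y : Fin n) → x ≢ y →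
    Σ ℕ λ m → Σ (Walk G x y m) λ p → RainbowPath G c p

CodesDiffer : ∀ {n k} → Graph n → (Fin n → Fin k) → Fin n → Fin n → Set
CodesDiffer {k = k} G c u v =
  Σ (Fin k) λ i → Σ ℕ λ a → Σ ℕ λ b →
    DistToSet G u (Class c i) a × DistToSet G v (Class c i) b × a ≢ b

-- locating rainbow k-colouring; the colouring is required to be onto
-- (all colour classes nonempty) so that rainbow codes are defined
LocatingRainbowColoring : ∀ {n k} → Graph n → (Fin n → Fin k) → Set
LocatingRainbowColoring {n} {k} G c =
  (∀ (i : Fin k) → Σ (Fin n) λ v → c v ≡ i) ×
  RainbowVertexColoring G c ×
  (∀ (u v : Fin n) → u ≢ v → CodesDiffer G c u v)

IsRVCL : ∀ {n} → Graph n → ℕ → Set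
IsRVCL {n} G r =
  (Σ (Fin n → Fin r) λ c → LocatingRainbowColoring G c) ×
  (∀ k → k < r → ¬ (Σ (Fin n → Fin k) λ c → LocatingRainbowColoring G c))

AtMost : {A : Set} → (A → Set) → ℕ → Set
AtMost {A} P N = ∀ (L : List A) → Unique L → All P L → length L ≤ N

colourBound : ℕ → ℕ → ℕ
colourBound t r = 1 + sum (applyUpTo (λ i → (r ∸ 1) C (t ∸ suc i)) (t ∸ 1))

-- In a graph of order n where every vertex misses exactly t − 1 others, two vertices have
-- n − t neighbours each, so when 2(n − t) > n − 2 any two non-adjacent vertices share a
-- neighbour and the distance from a vertex to a colour class is 0, 1 or 2 according to
-- whether the vertex lies in the class, sees it, or neither.  A vertex sees every class
-- but at most t − 1, which bounds (1) and (3).  For (2), a vertex of colour w is located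
-- by the set of colours ≠ w missing from its neighbourhood: a subset of size at most t − 1
-- of the other r − 1 colours, and there are Σ_{j<t} C(r − 1, j) of those.
module Submission where

open import Defs hiding (sym)
open import Data.Bool using (Bool; true; false; T)
open import Data.Bool.Properties using (T?; not-injective)
open import Data.Empty using (⊥-elim)
open import Data.Fin using (Fin; zero; suc; _↑ˡ_; _↑ʳ_; splitAt; punchIn; punchOut)
open import Data.Fin.Properties
  using (_≟_; any?; suc-injective; injective⇒≤; ↑ˡ-injective; ↑ʳ-injective; splitAt-↑ˡ; splitAt-↑ʳ;
         punchIn-injective; punchInᵢ≢i; punchIn-punchOut)
open import Data.List using (List; []; _∷_; length; map; lookup; filterᵇ; allFin)
open import Data.List.Properties using (length-map; length-++)
open import Data.List.Membership.Propositional using (_∈_)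
open import Data.List.Membership.Propositional.Properties using (∈-lookup; ∈-filter⁻)
open import Data.List.Relation.Unary.All using (All; []; _∷_)
import Data.List.Relation.Unary.All as All
import Data.List.Relation.Unary.All.Properties as All
open import Data.List.Relation.Unary.AllPairs using ([]; _∷_)
open import Data.List.Relation.Unary.Unique.Propositional using (Unique)
import Data.List.Relation.Unary.Unique.Propositional.Properties as Unique
open import Data.Nat using (ℕ; zero; suc; _+_; _≤_; _<_; _≥_; _∸_; z≤n; s≤s)
open import Data.Nat.Combinatorics using (_C_; nCk+nC[k+1]≡[n+1]C[k+1])
open import Data.Nat.Properties using (n≮0; ∸-monoˡ-≤; +-comm; +-suc; m+n≤o⇒m≤o∸n; m∸[m∸n]≡n; <⇒≱)
open import Data.Nat.Solver using (module +-*-Solver)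
open import Data.Product using (∃; _×_; _,_; proj₁; proj₂)
open import Data.Sum using (_⊎_; inj₁; inj₂)
open import Function using (_∘_; id)
open import Function.Definitions using (Injective)
open import Relation.Binary.PropositionalEquality
  using (_≡_; _≢_; refl; sym; trans; cong; cong₂; subst; module ≡-Reasoning)
open import Relation.Nullary using (¬_; Dec; yes; no)
open import Relation.Nullary.Decidable using (_×-dec_; ⌊_⌋; isNo; toWitnessFalse)

module _ {A : Set} where

  lookup-injective : ∀ {xs : List A} → Unique xs → ∀ {i j} → lookup xs i ≡ lookup xs j → i ≡ j
  lookup-injective (_    ∷ _)   {zero}  {zero}  _  = refl
  lookup-injective (x∉xs ∷ _)   {zero}  {suc j} eq = ⊥-elim (All.lookup x∉xs (∈-lookup j) eq)
  lookup-injective (x∉xs ∷ _)   {suc i} {zero}  eq = ⊥-elim (All.lookup x∉xs (∈-lookup i) (sym eq))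
  lookup-injective (_    ∷ xs!) {suc i} {suc j} eq = cong suc (lookup-injective xs! eq)

  atMost-fromInjection : ∀ {P : A → Set} {N} (f : ∀ x → P x → Fin N) →
    (∀ {x y} px py → f x px ≡ f y py → x ≡ y) → AtMost P N
  atMost-fromInjection f f-injective L L! PL =
    injective⇒≤ {f = λ i → f (lookup L i) (All.lookup PL (∈-lookup i))}
      (lookup-injective L! ∘ f-injective _ _)

  atMost-pullback : ∀ {B : Set} {P : A → Set} {Q : B → Set} {N} (g : A → B) → Injective _≡_ _≡_ g →
    (∀ {x} → P x → Q (g x)) → AtMost Q N → AtMost P N
  atMost-pullback g g-injective P⇒Q bound L L! PL = subst (_≤ _) (length-map g L)
    (bound (map g L) (Unique.map⁺ g-injective L!) (All.map⁺ (All.map P⇒Q PL)))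

  atMost-remove : ∀ {P : A → Set} {N x} → P x → AtMost P N → AtMost (λ z → x ≢ z × P z) (N ∸ 1)
  atMost-remove px bound L L! PL =
    ∸-monoˡ-≤ 1 (bound (_ ∷ L) (All.map proj₁ PL ∷ L!) (px ∷ All.map proj₂ PL))

  atMost-zero : ∀ {P : A → Set} {x} → AtMost P 0 → ¬ P x
  atMost-zero bound px = n≮0 (bound (_ ∷ []) ([] ∷ []) (px ∷ []))

-- The number of subsets of an m-element set with at most k elements, by Pascal's rule.
_C≤_ : ℕ → ℕ → ℕ
_     C≤ zero  = 1
zero  C≤ suc k = 1
suc m C≤ suc k = m C≤ suc k + m C≤ k

C≤-suc : ∀ m k → m C≤ suc k ≡ m C suc k + m C≤ k
C≤-suc zero    zero    = refl
C≤-suc zero    (suc k) = refl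
C≤-suc (suc m) zero    = begin
  m C≤ 1 + 1            ≡⟨ cong (_+ 1) (C≤-suc m 0) ⟩
  (m C 1 + 1) + 1       ≡⟨ cong (_+ 1) (+-comm (m C 1) 1) ⟩
  (m C 0 + m C 1) + 1   ≡⟨ cong (_+ 1) (nCk+nC[k+1]≡[n+1]C[k+1] m 0) ⟩
  suc m C 1 + 1         ∎
  where open ≡-Reasoning
C≤-suc (suc m) (suc k) = begin
  m C≤ suc (suc k) + m C≤ suc k                          ≡⟨ cong₂ _+_ (C≤-suc m (suc k)) (C≤-suc m k) ⟩
  (m C suc (suc k) + m C≤ suc k) + (m C suc k + m C≤ k)  ≡⟨ rearrange (m C suc (suc k)) (m C≤ suc k) (m C suc k) (m C≤ k) ⟩
  (m C suc k + m C suc (suc k)) + (m C≤ suc k + m C≤ k)  ≡⟨ cong (_+ suc m C≤ suc k) (nCk+nC[k+1]≡[n+1]C[k+1] m (suc k)) ⟩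
  suc m C suc (suc k) + suc m C≤ suc k                   ∎
  where
  open ≡-Reasoning
  open +-*-Solver
  rearrange : ∀ a b c d → (a + b) + (c + d) ≡ (c + a) + (b + d)
  rearrange = solve 4 (λ a b c d → (a :+ b) :+ (c :+ d) := (c :+ a) :+ (b :+ d)) refl

colourBound≡C≤ : ∀ t r → colourBound t r ≡ (r ∸ 1) C≤ (t ∸ 1)
colourBound≡C≤ zero          r = refl
colourBound≡C≤ (suc zero)    r = refl
colourBound≡C≤ (suc (suc k)) r = begin
  colourBound (suc (suc k)) r              ≡⟨ sym (+-suc _ _) ⟩
  (r ∸ 1) C suc k + colourBound (suc k) r  ≡⟨ cong ((r ∸ 1) C suc k +_) (colourBound≡C≤ (suc k) r) ⟩
  (r ∸ 1) C suc k + (r ∸ 1) C≤ k           ≡⟨ sym (C≤-suc (r ∸ 1) k) ⟩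
  (r ∸ 1) C≤ suc k                         ∎
  where open ≡-Reasoning

module _ {m : ℕ} {q : Fin (suc m) → Bool} where

  atMost-tail : ∀ {k} → AtMost (T ∘ q) k → AtMost (T ∘ q ∘ suc) k
  atMost-tail = atMost-pullback suc suc-injective id

  atMost-tail-withHead : ∀ {k} → T (q zero) → AtMost (T ∘ q) (suc k) → AtMost (T ∘ q ∘ suc) k
  atMost-tail-withHead q₀ bound =
    atMost-pullback suc suc-injective (λ qj → (λ ()) , qj) (atMost-remove q₀ bound)

rank : ∀ {m} k (q : Fin m → Bool) → AtMost (T ∘ q) k → Fin (m C≤ k)
rank         zero    q _ = zero
rank {zero}  (suc k) q _ = zero
rank {suc m} (suc k) q bound with T? (q zero)
... | no  _  = rank (suc k) (q ∘ suc) (atMost-tail bound) ↑ˡ m C≤ k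
... | yes q₀ = m C≤ suc k ↑ʳ rank k (q ∘ suc) (atMost-tail-withHead q₀ bound)

↑ˡ≢↑ʳ : ∀ {m n} (i : Fin m) (j : Fin n) → i ↑ˡ n ≢ m ↑ʳ j
↑ˡ≢↑ʳ {m} {n} i j eq with trans (sym (splitAt-↑ˡ m i n)) (trans (cong (splitAt m) eq) (splitAt-↑ʳ m n j))
... | ()

T-extensional : ∀ {x y : Bool} → (T x → T y) → (T y → T x) → x ≡ y
T-extensional {false} {false} _   _   = refl
T-extensional {false} {true}  _   y⇒x = ⊥-elim (y⇒x _)
T-extensional {true}  {false} x⇒y _   = ⊥-elim (x⇒y _)
T-extensional {true}  {true}  _   _   = refl

rank-injective : ∀ {m} k (q q' : Fin m → Bool) b b' → rank k q b ≡ rank k q' b' → ∀ j → q j ≡ q' j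
rank-injective zero q q' b b' _ j = T-extensional (⊥-elim ∘ atMost-zero b) (⊥-elim ∘ atMost-zero b')
rank-injective {suc m} (suc k) q q' b b' eq j with T? (q zero) | T? (q' zero)
rank-injective {suc m} (suc k) q q' b b' eq zero    | no ¬q₀ | no ¬q'₀ =
  T-extensional (⊥-elim ∘ ¬q₀) (⊥-elim ∘ ¬q'₀)
rank-injective {suc m} (suc k) q q' b b' eq (suc j) | no _   | no _    =
  rank-injective (suc k) (q ∘ suc) (q' ∘ suc) (atMost-tail b) (atMost-tail b') (↑ˡ-injective _ _ _ eq) j
rank-injective {suc m} (suc k) q q' b b' eq zero    | yes q₀ | yes q'₀ =
  T-extensional (λ _ → q'₀) (λ _ → q₀)
rank-injective {suc m} (suc k) q q' b b' eq (suc j) | yes q₀ | yes q'₀ =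
  rank-injective k (q ∘ suc) (q' ∘ suc) (atMost-tail-withHead q₀ b) (atMost-tail-withHead q'₀ b')
    (↑ʳ-injective _ _ _ eq) j
rank-injective {suc m} (suc k) q q' b b' eq j       | no _   | yes _   = ⊥-elim (↑ˡ≢↑ʳ _ _ eq)
rank-injective {suc m} (suc k) q q' b b' eq j       | yes _  | no _    = ⊥-elim (↑ˡ≢↑ʳ _ _ (sym eq))

module _ {n : ℕ} (G : Graph n) where

  Adj-sym : ∀ {u v} → Adj G u v → Adj G v u
  Adj-sym {u} {v} = subst T (Graph.sym G u v)

  Adj-irrefl : ∀ {v} → ¬ Adj G v v
  Adj-irrefl {v} = subst T (irrefl G v)

  neighbours : Fin n → List (Fin n)
  neighbours x = filterᵇ (adj G x) (allFin n)

  ∈-neighbours⁻ : ∀ {x z} → z ∈ neighbours x → Adj G x z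
  ∈-neighbours⁻ {x} z∈N = proj₂ (∈-filter⁻ (T? ∘ adj G x) {xs = allFin n} z∈N)

  neighbours-unique : ∀ x → Unique (neighbours x)
  neighbours-unique x = Unique.filter⁺ (T? ∘ adj G x) (Unique.allFin⁺ n)

  NeighbourIn : Fin n → (Fin n → Set) → Set
  NeighbourIn u S = ∃ λ z → S z × Adj G u z

  DiameterTwo : Set
  DiameterTwo = ∀ x y → x ≢ y → ¬ Adj G x y → ∃ λ z → Adj G x z × Adj G z y

  module _ {t : ℕ} (regular : Regular G (n ∸ t)) (t≤n : t ≤ n) where

    nonNeighbours-atMost : ∀ x → AtMost (λ z → ¬ Adj G x z) t
    nonNeighbours-atMost x L L! L≁x = subst (length L ≤_) (m∸[m∸n]≡n t≤n)
      (m+n≤o⇒m≤o∸n (length L) (subst (_≤ n) (trans (length-++ L) (cong (length L +_) (regular x)))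
        (injective⇒≤ (lookup-injective (Unique.++⁺ L! (neighbours-unique x) disjoint)))))
      where
      disjoint : ∀ {z} → ¬ (z ∈ L × z ∈ neighbours x)
      disjoint (z∈L , z∈N) = All.lookup L≁x z∈L (∈-neighbours⁻ z∈N)

    otherNonNeighbours-atMost : ∀ x → AtMost (λ z → x ≢ z × ¬ Adj G x z) (t ∸ 1)
    otherNonNeighbours-atMost x = atMost-remove Adj-irrefl (nonNeighbours-atMost x)

    regular⇒diameterTwo : t < 2 + (n ∸ t) → DiameterTwo
    regular⇒diameterTwo t<2+d x y x≢y x≁y with any? (λ z → T? (adj G x z) ×-dec T? (adj G z y))
    ... | yes common = common
    ... | no ¬common = ⊥-elim (<⇒≱ t<2+d (subst (λ d → 2 + d ≤ t) (regular x)
            (nonNeighbours-atMost y (y ∷ x ∷ neighbours x) unique nonAdjacent)))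
      where
      ∉neighbours : ∀ {v} → ¬ Adj G x v → All (v ≢_) (neighbours x)
      ∉neighbours x≁v = All.tabulate λ z∈N v≡z → x≁v (subst (Adj G x) (sym v≡z) (∈-neighbours⁻ z∈N))
      unique : Unique (y ∷ x ∷ neighbours x)
      unique = ((x≢y ∘ sym) ∷ ∉neighbours x≁y) ∷ ∉neighbours Adj-irrefl ∷ neighbours-unique x
      nonAdjacent : All (λ z → ¬ Adj G y z) (y ∷ x ∷ neighbours x)
      nonAdjacent = Adj-irrefl ∷ (x≁y ∘ Adj-sym) ∷
        All.tabulate λ z∈N y∼z → ¬common (_ , ∈-neighbours⁻ z∈N , Adj-sym y∼z)

module _ {n : ℕ} {G : Graph n} where

  Walk0⇒≡ : ∀ {u v} → Walk G u v 0 → u ≡ v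
  Walk0⇒≡ [] = refl

  Walk1⇒Adj : ∀ {u v} → Walk G u v 1 → Adj G u v
  Walk1⇒Adj (u∼v ∷ []) = u∼v

module _ {n : ℕ} {G : Graph n} {S : Fin n → Set} {u : Fin n} where

  distToSet≡0 : ∀ {a} → S u → DistToSet G u S a → a ≡ 0
  distToSet≡0 {zero}  _  _             = refl
  distToSet≡0 {suc a} Su (_ , minimal) = ⊥-elim (minimal u Su 0 (s≤s z≤n) [])

  distToSet≢0 : ∀ {a} → ¬ S u → DistToSet G u S a → a ≢ 0
  distToSet≢0 ¬Su ((y , Sy , p) , _) refl = ¬Su (subst S (sym (Walk0⇒≡ p)) Sy)

  distToSet≡1 : ∀ {a} → ¬ S u → NeighbourIn G u S → DistToSet G u S a → a ≡ 1
  distToSet≡1 {zero}        ¬Su _              d             = ⊥-elim (distToSet≢0 ¬Su d refl)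
  distToSet≡1 {suc zero}    _   _              _             = refl
  distToSet≡1 {suc (suc a)} _   (z , Sz , u∼z) (_ , minimal) =
    ⊥-elim (minimal z Sz 1 (s≤s (s≤s z≤n)) (u∼z ∷ []))

  distToSet≡2 : ∀ {a} → DiameterTwo G → ¬ S u → ¬ NeighbourIn G u S → ∃ S → DistToSet G u S a → a ≡ 2
  distToSet≡2 {zero}              _    ¬Su _    _        d                  = ⊥-elim (distToSet≢0 ¬Su d refl)
  distToSet≡2 {suc zero}          _    _   ¬nbr _        ((y , Sy , p) , _) = ⊥-elim (¬nbr (y , Sy , Walk1⇒Adj p))
  distToSet≡2 {suc (suc zero)}    _    _   _    _        _                  = refl
  distToSet≡2 {suc (suc (suc a))} diam ¬Su ¬nbr (y , Sy) (_ , minimal)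
    with z , u∼z , z∼y ← diam u y (λ u≡y → ¬Su (subst S (sym u≡y) Sy)) (λ u∼y → ¬nbr (y , Sy , u∼y))
    = ⊥-elim (minimal y Sy 2 (s≤s (s≤s (s≤s z≤n))) (u∼z ∷ z∼y ∷ []))

  distToSet≥2⇒nonAdjacent : ∀ {a y} → DistToSet G u S (suc (suc a)) → S y → u ≢ y × ¬ Adj G u y
  distToSet≥2⇒nonAdjacent {y = y} (_ , minimal) Sy =
    (λ u≡y → minimal y Sy 0 (s≤s z≤n) (subst (λ v → Walk G u v 0) u≡y [])) ,
    (λ u∼y → minimal y Sy 1 (s≤s (s≤s z≤n)) (u∼y ∷ []))

distToSet-determinedByNeighbours : ∀ {n} {G : Graph n} → DiameterTwo G → ∀ {S : Fin n → Set} → ∃ S →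
  ∀ {u v a b} → ¬ S u → ¬ S v →
  (u? : Dec (NeighbourIn G u S)) (v? : Dec (NeighbourIn G v S)) → ⌊ u? ⌋ ≡ ⌊ v? ⌋ →
  DistToSet G u S a → DistToSet G v S b → a ≡ b
distToSet-determinedByNeighbours diam nonempty ¬Su ¬Sv (yes u∼S) (yes v∼S) _ du dv =
  trans (distToSet≡1 ¬Su u∼S du) (sym (distToSet≡1 ¬Sv v∼S dv))
distToSet-determinedByNeighbours diam nonempty ¬Su ¬Sv (no u≁S)  (no v≁S)  _ du dv =
  trans (distToSet≡2 diam ¬Su u≁S nonempty du) (sym (distToSet≡2 diam ¬Sv v≁S nonempty dv))

module _ {n t m : ℕ} {G : Graph n} (regular : Regular G (n ∸ t)) (t≤n : t ≤ n) (diam : DiameterTwo G)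
         (c : Fin n → Fin (suc m)) (onto : ∀ i → ∃ λ v → c v ≡ i) where

  representative : Fin (suc m) → Fin n
  representative i = proj₁ (onto i)

  representative-injective : Injective _≡_ _≡_ representative
  representative-injective {i} {j} eq = trans (sym (proj₂ (onto i))) (trans (cong c eq) (proj₂ (onto j)))

  distance2Colours-atMost : ∀ v → AtMost (λ i → DistToSet G v (Class c i) 2) (t ∸ 1)
  distance2Colours-atMost v = atMost-pullback representative representative-injective
    (λ d → distToSet≥2⇒nonAdjacent d (proj₂ (onto _))) (otherNonNeighbours-atMost G regular t≤n v)

  distance2Vertices-atMost : ∀ w → AtMost (λ v → DistToSet G v (Class c w) 2) (t ∸ 1)
  distance2Vertices-atMost w =
    atMost-pullback id id far (otherNonNeighbours-atMost G regular t≤n (representative w))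
    where
    far : ∀ {v} → DistToSet G v (Class c w) 2 → representative w ≢ v × ¬ Adj G (representative w) v
    far d with v≢y , v≁y ← distToSet≥2⇒nonAdjacent d (proj₂ (onto w)) = v≢y ∘ sym , v≁y ∘ Adj-sym G

  neighbourIn? : ∀ u i → Dec (NeighbourIn G u (Class c i))
  neighbourIn? u i = any? λ z → (c z ≟ i) ×-dec T? (adj G u z)

  module _ (w : Fin (suc m)) where

    missingColours : Fin n → Fin m → Bool
    missingColours u j = isNo (neighbourIn? u (punchIn w j))

    missingColours-atMost : ∀ {u} → c u ≡ w → AtMost (T ∘ missingColours u) (t ∸ 1)
    missingColours-atMost {u} cu≡w = atMost-pullback (representative ∘ punchIn w)
      (punchIn-injective w _ _ ∘ representative-injective) far (otherNonNeighbours-atMost G regular t≤n u)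
      where
      far : ∀ {j} → T (missingColours u j) →
            u ≢ representative (punchIn w j) × ¬ Adj G u (representative (punchIn w j))
      far {j} missing =
        (λ u≡y → punchInᵢ≢i w j (trans (sym (proj₂ (onto _))) (trans (cong c (sym u≡y)) cu≡w))) ,
        (λ u∼y → toWitnessFalse missing (_ , proj₂ (onto _) , u∼y))

    sameMissingColours⇒sameCode : ∀ {u v} → c u ≡ w → c v ≡ w →
      (∀ j → missingColours u j ≡ missingColours v j) → ¬ CodesDiffer G c u v
    sameMissingColours⇒sameCode {u} {v} cu≡w cv≡w same (i , a , b , du , dv , a≢b) with i ≟ w
    ... | yes i≡w = a≢b (trans (distToSet≡0 (trans cu≡w (sym i≡w)) du)
                               (sym (distToSet≡0 (trans cv≡w (sym i≡w)) dv)))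
    ... | no  i≢w = a≢b (distToSet-determinedByNeighbours diam (onto i) (otherColour cu≡w) (otherColour cv≡w)
                          (neighbourIn? u i) (neighbourIn? v i) sameNeighbourhood du dv)
      where
      otherColour : ∀ {x} → c x ≡ w → c x ≢ i
      otherColour cx≡w cx≡i = i≢w (trans (sym cx≡i) cx≡w)
      w≢i : w ≢ i
      w≢i = i≢w ∘ sym
      sameNeighbourhood : ⌊ neighbourIn? u i ⌋ ≡ ⌊ neighbourIn? v i ⌋
      sameNeighbourhood = subst (λ k → ⌊ neighbourIn? u k ⌋ ≡ ⌊ neighbourIn? v k ⌋)
        (punchIn-punchOut w≢i) (not-injective (same (punchOut w≢i)))

    classCode : ∀ u → c u ≡ w → Fin (m C≤ (t ∸ 1))
    classCode u cu≡w = rank (t ∸ 1) (missingColours u) (missingColours-atMost cu≡w)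

    colourClass-atMost : (∀ u v → u ≢ v → CodesDiffer G c u v) → AtMost (λ v → c v ≡ w) (m C≤ (t ∸ 1))
    colourClass-atMost locating = atMost-fromInjection classCode classCode-injective
      where
      classCode-injective : ∀ {u v} cu≡w cv≡w → classCode u cu≡w ≡ classCode v cv≡w → u ≡ v
      classCode-injective {u} {v} cu≡w cv≡w eq with u ≟ v
      ... | yes u≡v = u≡v
      ... | no  u≢v = ⊥-elim (sameMissingColours⇒sameCode cu≡w cv≡w
                                (rank-injective (t ∸ 1) (missingColours u) (missingColours v)
                                   (missingColours-atMost cu≡w) (missingColours-atMost cv≡w) eq)
                                (locating u v u≢v))

deficiency-bounds : ∀ {n t} → n ≥ 5 → t ≡ 2 ⊎ t ≡ 3 → t ≤ n × t < 2 + (n ∸ t)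
deficiency-bounds (s≤s (s≤s (s≤s (s≤s (s≤s _))))) (inj₁ refl) = s≤s (s≤s z≤n) , s≤s (s≤s (s≤s z≤n))
deficiency-bounds (s≤s (s≤s (s≤s (s≤s (s≤s _))))) (inj₂ refl) =
  s≤s (s≤s (s≤s z≤n)) , s≤s (s≤s (s≤s (s≤s z≤n)))

lemma3 : (n t r : ℕ) → n ≥ 5 → (t ≡ 2 ⊎ t ≡ 3) →
    (G : Graph n) → Connected G → Regular G (n ∸ t) →
    IsRVCL G r → r ≥ 3 →
    (c : Fin n → Fin r) → LocatingRainbowColoring G c →
    (∀ (v : Fin n) → AtMost (λ (i : Fin r) → DistToSet G v (Class c i) 2) (t ∸ 1))
    × (∀ (w : Fin r) → AtMost (λ (v : Fin n) → c v ≡ w) (colourBound t r))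
    × (∀ (w : Fin r) → AtMost (λ (v : Fin n) → DistToSet G v (Class c w) 2) (t ∸ 1))
lemma3 n t (suc m) n≥5 t∈ G _ regular _ _ c (onto , _ , locating) =
  distance2Colours-atMost regular t≤n diam c onto ,
  (λ w → subst (AtMost _) (sym (colourBound≡C≤ t (suc m)))
           (colourClass-atMost regular t≤n diam c onto w locating)) ,
  distance2Vertices-atMost regular t≤n diam c onto
  where
  t≤n : t ≤ n
  t≤n = proj₁ (deficiency-bounds n≥5 t∈)
  diam : DiameterTwo G
  diam = regular⇒diameterTwo G regular t≤n (proj₂ (deficiency-bounds n≥5 t∈))
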